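{- For every DML query $Q$, the rewriting system $\mathcal{R}^{\mathrm{dml}}(Q)$ is terminating, i.e. admits no infinite sequence of one-step rewrites.
   Context: Setting. $\Sigma$ is an order-sorted algebraic signature with sorts $\mathsf{Fact}$ and $\mathsf{Bool}$, $\mathcal{D}$ a $\Sigma$-algebra of facts presented by equational attributes $A$ (associativity, commutativity, identity) and directed equations confluent and terminating modulo $A$, defining Boolean connectives and Boolean equality on every sort; every ground $\mathsf{Bool}$ term reduces to $\mathit{true}$ or $\mathit{false}$. Terms are fully reduced, compared modulo $A$. Finite multisets of facts use an associative-commutative union $\circ$ with identity $\emptyset$. Nominal sorts and fresh facts: a nominal sort $s$ has values $\imath^s_n$ ($n\in\mathbb{N}$) with no structure besides equality. For each nominal sort $s$ there is a fresh-fact constructor $C_s$; fresh facts $C_s(\imath^s_m)$ form multisets (AC union $\circ$, identity $\emptyset$) distinct from ordinary facts; $\upsilon(C_{s_1}(\imath^{s_1}_{m_1})\circ\cdots\circ C_{s_k}(\imath^{s_k}_{m_k}))=C_{s_1}(\imath^{s_1}_{m_1+1})\circ\cdots\circ C_{s_k}(\imath^{s_k}_{m_k+1})$. Patterns: AC $\circ$-combinations of blocks $[F]_!$, $[F]_?$, $[F]_0$ ($F$ non-empty multiset of possibly non-ground facts) and $[F]_\ast$ ($F$ non-empty multiset of possibly non-ground fresh facts), with $[F_1]_m\circ[F_2]_m=[F_1\circ F_2]_m$; $P_!,P_?,P_0,P_\ast$ are the multisets in the respective blocks ($\emptyset$ if absent). $P$ is terminating-and-preserving if it has only $!$- and $?$-blocks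 and $P_?\ne\emptyset$; terminating if $P_?\ne\emptyset$; semi-terminating if $P_?\circ P_0\ne\emptyset$. Conditions: $\mathsf{False}$; $\{B\}$ ($B$ a $\mathsf{Bool}$ term); $\neg\psi$; $\psi_1\vee\psi_2$; $\exists P.\psi$ ($P$ terminating-and-preserving), binding in $\psi$ the variables of $P$ not bound by the context. Condition rewriting on stacks $T$ of frames $\mathsf{Res}(B)$, $\mathsf{Not}$, $[\vec a]^{\vec v}_\psi$, $[\vec a]^{\vec v,\downarrow}_\psi$, $[G\mid\vec a]^{\vec v}_{\exists P.\psi}$ ($\sigma=\{\vec a/\vec v\}$) over a database $F$, "$X\mapsto Y$" replacing the top segment $X$ by $Y$: (1) $[\vec a]_{\mathsf{False}}\mapsto\mathsf{Res}(\mathit{false})$, $[\vec a]^{\vec v}_{\{B\}}\mapsto\mathsf{Res}(\sigma(B))$; (2) $[\vec a]_{\neg\psi}\mapsto\mathsf{Not}[\vec a]_\psi$, $\mathsf{Not}\,\mathsf{Res}(B)\mapsto\mathsf{Res}(\neg B)$; (3) $[\vec a]_{\psi_1\vee\psi_2}\mapsto[\vec a]^{\downarrow}_{\psi_1}[\vec a]_{\psi_2}$, $[\vec a]^{\downarrow}_\psi\mathsf{Res}(\mathit{true})\mapsto\mathsf{Res}(\mathit{true})$, $[\vec a]^{\downarrow}_\psi\mathsf{Res}(\mathit{false})\mapsto[\vec a]_\psi$; (4) $[\vec a]_{\exists P.\psi}\mapsto[F\mid\vec a]_{\exists P.\psi}$; (5) with $\vec w$ the variables of $P$ not in $\vec v$,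 if $G=G'\circ\sigma'(P_!\circ P_?)$, $\sigma'=\{\vec a/\vec v,\vec b/\vec w\}$, then $[G\mid\vec a]_{\exists P.\psi}\mapsto[G'\circ\sigma'(P_!)\mid\vec a]_{\exists P.\psi}[\vec a,\vec b]^{\vec v,\vec w}_\psi$; (6) $[G\mid\vec a]_{\exists P.\psi}\mathsf{Res}(\mathit{false})\mapsto[G\mid\vec a]_{\exists P.\psi}$, $[G\mid\vec a]_{\exists P.\psi}\mathsf{Res}(\mathit{true})\mapsto\mathsf{Res}(\mathit{true})$; (7) if no decomposition as in (5) exists, $[G\mid\vec a]_{\exists P.\psi}\mapsto\mathsf{Res}(\mathit{false})$. DML queries: $\mathsf{ok}$; $\emptyset$; any fact $f$; $D_1\oplus D_2$; $\varphi\Rightarrow D$; $\mathsf{From}\,P.\,D$ where either $P$ is terminating, or $P$ is semi-terminating and $D$ is success-assured; success-assured DML queries are $\mathsf{ok}$, facts, and $D_1\oplus D_2$ with $D_1$ or $D_2$ success-assured. $\mathsf{From}\,P$ binds in $D$ the variables of $P$ not bound by the context. DML system $\mathcal{R}^{\mathrm{dml}}(Q)$: states $\{F,F',F_\ast,S\}^d$ ($F$ current database, $F'$ facts to be added, $F_\ast$ ground fresh facts, $S$ stack, top at right) or $\mathsf{New}(G,G_\ast)$, $\mathsf{Fail}(G,G_\ast)$. Frames: $\mathsf{Ok}$; $[\vec a]^{\vec v}_R$; marked $[\vec a]^{\vec v,\downarrow}_R$; $[\vec a\mid T]^{\vec v}_R$ ($T$ condition stack); iterator $[G\mid\vec a\mid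 B]^{\vec v}_{\mathsf{From}\,P.R}$ ($B$ Boolean); tentative iterator $[G\mid\vec a\mid B,H]^{\vec v}_{\mathsf{From}\,P.R}$ ($H$ multiset of facts); $R$ a DML subquery. Rules ("$X\mapsto Y$" replaces the top segment of $S$, other components unchanged unless stated): $\mathsf{Ok}\,\mathsf{Ok}\mapsto\mathsf{Ok}$; $[\vec a]_{\mathsf{ok}}\mapsto\mathsf{Ok}$; $[\vec a]_\emptyset\mapsto$ (popped); $[\vec a]_f\mapsto\mathsf{Ok}$ with $\sigma(f)$ added to $F'$; $[\vec a]_{R_1\oplus R_2}\mapsto[\vec a]^{\downarrow}_{R_2}[\vec a]_{R_1}$; $[\vec a]^{\downarrow}_R\,\mathsf{Ok}\mapsto\mathsf{Ok}\,[\vec a]_R$; $[\vec a]^{\downarrow}_R\mapsto[\vec a]_R$ (when on top); $[\vec a]^{\vec v}_{\varphi\Rightarrow R}\mapsto[\vec a\mid[\vec a]^{\vec v}_\varphi]_R$; $[\vec a\mid T]_R\mapsto[\vec a\mid T']_R$ when $T$ rewrites to $T'$ by a condition rule over $F$; $[\vec a\mid\mathsf{Res}(\mathit{false})]_R$ popped; $[\vec a\mid\mathsf{Res}(\mathit{true})]_R\mapsto[\vec a]_R$; $[\vec a]_{\mathsf{From}\,P.R}\mapsto[F\mid\vec a\mid\mathit{false}]_{\mathsf{From}\,P.R}$; unfolding: if, for $\sigma'=\{\vec a/\vec v,\vec b/\vec w\}$ ($\vec w$ the variables of $P$ not in $\vec v$), $F=K\circ\sigma'(P_!\circ P_?\circ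 P_0)$, $F_\ast=K_\ast\circ\sigma'(P_\ast)$ and $G=G'\circ\sigma'(P_!\circ P_?\circ P_0)$, then $\{F,F',F_\ast,S[G\mid\vec a\mid B]_{\mathsf{From}\,P.R}\}^d\to\{K\circ\sigma'(P_!\circ P_?),F',K_\ast\circ\upsilon(\sigma'(P_\ast)),S[G'\circ\sigma'(P_!)\mid\vec a\mid B,\sigma'(P_0)]_{\mathsf{From}\,P.R}[\vec a,\vec b]^{\vec v,\vec w}_R\}^d$; $\{F,F',F_\ast,S[G\mid\vec a\mid B,H]_{\mathsf{From}\,P.R}\}^d\to\{F\circ H,F',F_\ast,S[G\circ H\mid\vec a\mid B]_{\mathsf{From}\,P.R}\}^d$; $[G\mid\vec a\mid B,H]_{\mathsf{From}\,P.R}\,\mathsf{Ok}\mapsto[G\mid\vec a\mid\mathit{true}]_{\mathsf{From}\,P.R}$; if $G$ has no decomposition $G'\circ\sigma'(P_!\circ P_?\circ P_0)$, $[G\mid\vec a\mid B]_{\mathsf{From}\,P.R}\mapsto\mathsf{Ok}$ if $B=\mathit{true}$, and is popped if $B=\mathit{false}$; $\{F,F',F_\ast,\mathsf{Ok}\}^d\to\mathsf{New}(F\circ F',F_\ast)$; $\{F,F',F_\ast,\text{empty}\}^d\to\mathsf{Fail}(F\circ F',F_\ast)$. Matching is modulo $A$ and the equations. -}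

module Defs where

open import Level using (0ℓ)
open import Data.Nat using (ℕ; suc)
open import Data.Bool using (Bool; true; false; not)
open import Data.Product using (_×_; _,_; Σ; ∃; proj₁)
open import Data.Sum using (_⊎_)
open import Data.Empty using (⊥)
open import Data.Unit using (⊤)
open import Data.List using (List; []; _∷_; _++_; map; zip; concatMap; filter; deduplicate)
open import Data.List.Relation.Binary.Pointwise using (Pointwise)
open import Data.List.Relation.Binary.Permutation.Propositional using (_↭_)
open import Relation.Nullary using (¬_; ¬?)
open import Relation.Binary.Definitions using (DecidableEquality)
open import Relation.Binary.PropositionalEquality using (_≡_; _≢_)
import Data.List.Membership.DecPropositional as DecMem

-- * Fact      : ground facts, i.e. fully reduced ground terms of sort Fact;
--               propositional equality on Fact is equality modulo A.
-- * FactPat   : possibly non-ground terms of sort Fact (used in patterns and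
--               as the facts f of DML queries).
-- * BoolTerm  : possibly non-ground terms of sort Bool.
-- * Var, Val  : variables and ground (fully reduced) values; _⦂_ says that a
--               value has a sort admissible for the variable (order-sorted).
-- * instF / instB / instN : apply the substitution {a⃗/v⃗} (an environment)
--               and reduce to normal form; every ground Bool term reduces to
--               true or false, so instB returns a Bool.
-- * Nominal sorts NSort; ground fresh facts C_s(ι^s_m) are pairs (s , m);
--   FreshPat are possibly non-ground fresh facts.

record Setting : Set₁ where
  field
    Var      : Set
    _≟V_     : DecidableEquality Var
    Val      : Set
    _⦂_      : Val → Var → Set
    Fact     : Set
    FactPat  : Set
    BoolTerm : Set
    NSort    : Set
    FreshPat : Set
    varsF    : FactPat → List Var
    varsN    : FreshPat → List Var
    instF    : List (Var × Val) → FactPat → Fact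
    instB    : List (Var × Val) → BoolTerm → Bool
    instN    : List (Var × Val) → FreshPat → NSort × ℕ

module System (𝒮 : Setting) where
  open Setting 𝒮
  open DecMem _≟V_ using (_∈?_)

  FreshFact : Set
  FreshFact = NSort × ℕ

  υ : List FreshFact → List FreshFact
  υ = map (λ { (s , m) → (s , suc m) })

  Env : Set
  Env = List (Var × Val)

  -- finite multisets are lists, compared up to permutation (_↭_)
  Facts : Set
  Facts = List Fact

  instFs : Env → List FactPat → Facts
  instFs e = map (instF e)

  -- Patterns:  [P!]_! ∘ [P?]_? ∘ [P0]_0 ∘ [P*]_*  (absent block = [])
  record Pattern : Set where
    constructor pat
    field
      P! P? P0 : List FactPat
      P*       : List FreshPat
  open Pattern public

  TerminatingAndPreserving : Pattern → Set
  TerminatingAndPreserving P = (P0 P ≡ []) × (P* P ≡ []) × (P? P ≢ [])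

  TerminatingP : Pattern → Set
  TerminatingP P = P? P ≢ []

  SemiTerminating : Pattern → Set
  SemiTerminating P = (P? P ++ P0 P) ≢ []

  patVars : Pattern → List Var
  patVars P = deduplicate _≟V_
    (concatMap varsF (P! P ++ P? P ++ P0 P) ++ concatMap varsN (P* P))

  newVars : Env → Pattern → List Var
  newVars e P = filter (λ x → ¬? (x ∈? map proj₁ e)) (patVars P)

  Extends : Env → Pattern → Env → Set
  Extends e P e' = Σ (List Val) λ b →
    Pointwise (λ x y → y ⦂ x) (newVars e P) b × (e' ≡ e ++ zip (newVars e P) b)

  data Cond : Set where
    False : Cond
    bool  : BoolTerm → Cond
    neg   : Cond → Cond
    _∨_   : Cond → Cond → Cond
    ex    : Pattern → Cond → Cond

  data WFCond : Cond → Set where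
    False : WFCond False
    bool  : ∀ {B} → WFCond (bool B)
    neg   : ∀ {ψ} → WFCond ψ → WFCond (neg ψ)
    _∨_   : ∀ {ψ₁ ψ₂} → WFCond ψ₁ → WFCond ψ₂ → WFCond (ψ₁ ∨ ψ₂)
    ex    : ∀ {P ψ} → TerminatingAndPreserving P → WFCond ψ → WFCond (ex P ψ)

  data DML : Set where
    ok    : DML
    ∅     : DML
    fact  : FactPat → DML
    _⊕_   : DML → DML → DML
    _⇒_   : Cond → DML → DML
    From  : Pattern → DML → DML

  data SuccessAssured : DML → Set where
    ok   : SuccessAssured ok
    fact : ∀ {f} → SuccessAssured (fact f)
    ⊕ˡ   : ∀ {D₁ D₂} → SuccessAssured D₁ → SuccessAssured (D₁ ⊕ D₂)
    ⊕ʳ   : ∀ {D₁ D₂} → SuccessAssured D₂ → SuccessAssured (D₁ ⊕ D₂)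

  -- well-formed DML queries (the side conditions of the grammar)
  data WF : DML → Set where
    ok   : WF ok
    ∅    : WF ∅
    fact : ∀ {f} → WF (fact f)
    _⊕_  : ∀ {D₁ D₂} → WF D₁ → WF D₂ → WF (D₁ ⊕ D₂)
    _⇒_  : ∀ {φ D} → WFCond φ → WF D → WF (φ ⇒ D)
    From : ∀ {P D} → (TerminatingP P ⊎ (SemiTerminating P × SuccessAssured D))
           → WF D → WF (From P D)

  -- Condition rewriting.  Stacks are lists whose HEAD is the TOP
  -- (the paper writes the top at the right).
  data CFrame : Set where
    Res  : Bool → CFrame
    Not  : CFrame
    ev   : Env → Cond → CFrame
    ev↓  : Env → Cond → CFrame
    exI  : Facts → Env → Pattern → Cond → CFrame

  CStack : Set
  CStack = List CFrame

  Decomp : Facts → Env → Pattern → Env → List FactPat → Facts → Set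
  Decomp G e P e' X G' = Extends e P e' × (G ↭ G' ++ instFs e' X)

  infix 4 _⊢_⟶c_
  data _⊢_⟶c_ (F : Facts) : CStack → CStack → Set where
    r-false : ∀ {e T} → F ⊢ ev e False ∷ T ⟶c Res false ∷ T
    r-bool  : ∀ {e B T} → F ⊢ ev e (bool B) ∷ T ⟶c Res (instB e B) ∷ T
    r-neg   : ∀ {e ψ T} → F ⊢ ev e (neg ψ) ∷ T ⟶c ev e ψ ∷ Not ∷ T
    r-not   : ∀ {b T} → F ⊢ Res b ∷ Not ∷ T ⟶c Res (not b) ∷ T
    r-or    : ∀ {e ψ₁ ψ₂ T} → F ⊢ ev e (ψ₁ ∨ ψ₂) ∷ T ⟶c ev e ψ₂ ∷ ev↓ e ψ₁ ∷ T
    r-or-t  : ∀ {e ψ T} → F ⊢ Res true ∷ ev↓ e ψ ∷ T ⟶c Res true ∷ T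
    r-or-f  : ∀ {e ψ T} → F ⊢ Res false ∷ ev↓ e ψ ∷ T ⟶c ev e ψ ∷ T
    r-ex    : ∀ {e P ψ T} → F ⊢ ev e (ex P ψ) ∷ T ⟶c exI F e P ψ ∷ T
    r-match : ∀ {G e P ψ T e' G'} → Decomp G e P e' (P! P ++ P? P) G' →
              F ⊢ exI G e P ψ ∷ T ⟶c ev e' ψ ∷ exI (G' ++ instFs e' (P! P)) e P ψ ∷ T
    r-ex-f  : ∀ {G e P ψ T} → F ⊢ Res false ∷ exI G e P ψ ∷ T ⟶c exI G e P ψ ∷ T
    r-ex-t  : ∀ {G e P ψ T} → F ⊢ Res true ∷ exI G e P ψ ∷ T ⟶c Res true ∷ T
    r-nomatch : ∀ {G e P ψ T} →
              (¬ Σ Env λ e' → Σ Facts λ G' → Decomp G e P e' (P! P ++ P? P) G') →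
              F ⊢ exI G e P ψ ∷ T ⟶c Res false ∷ T

  data DFrame : Set where
    Ok   : DFrame
    q    : Env → DML → DFrame
    q↓   : Env → DML → DFrame
    cq   : Env → CStack → DML → DFrame
    it   : Facts → Env → Bool → Pattern → DML → DFrame
    itT  : Facts → Env → Bool → Facts → Pattern → DML → DFrame

  DStack : Set
  DStack = List DFrame

  data State : Set where
    st   : (F F' : Facts) (F* : List FreshFact) (S : DStack) → State
    New  : Facts → List FreshFact → State
    Fail : Facts → List FreshFact → State

  infix 4 _⟶_
  data _⟶_ : State → State → Set where
    ok-ok  : ∀ {F F' F* S} → st F F' F* (Ok ∷ Ok ∷ S) ⟶ st F F' F* (Ok ∷ S)
    q-ok   : ∀ {F F' F* S e} → st F F' F* (q e ok ∷ S) ⟶ st F F' F* (Ok ∷ S)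
    q-∅    : ∀ {F F' F* S e} → st F F' F* (q e ∅ ∷ S) ⟶ st F F' F* S
    q-fact : ∀ {F F' F* S e f} →
             st F F' F* (q e (fact f) ∷ S) ⟶ st F (instF e f ∷ F') F* (Ok ∷ S)
    q-⊕    : ∀ {F F' F* S e R₁ R₂} →
             st F F' F* (q e (R₁ ⊕ R₂) ∷ S) ⟶ st F F' F* (q e R₁ ∷ q↓ e R₂ ∷ S)
    ↓-ok   : ∀ {F F' F* S e R} →
             st F F' F* (Ok ∷ q↓ e R ∷ S) ⟶ st F F' F* (q e R ∷ Ok ∷ S)
    ↓-top  : ∀ {F F' F* S e R} →
             st F F' F* (q↓ e R ∷ S) ⟶ st F F' F* (q e R ∷ S)
    q-⇒    : ∀ {F F' F* S e φ R} →
             st F F' F* (q e (φ ⇒ R) ∷ S) ⟶ st F F' F* (cq e (ev e φ ∷ []) R ∷ S)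
    cq-step : ∀ {F F' F* S e T T' R} → F ⊢ T ⟶c T' →
             st F F' F* (cq e T R ∷ S) ⟶ st F F' F* (cq e T' R ∷ S)
    cq-f   : ∀ {F F' F* S e R} →
             st F F' F* (cq e (Res false ∷ []) R ∷ S) ⟶ st F F' F* S
    cq-t   : ∀ {F F' F* S e R} →
             st F F' F* (cq e (Res true ∷ []) R ∷ S) ⟶ st F F' F* (q e R ∷ S)
    q-From : ∀ {F F' F* S e P R} →
             st F F' F* (q e (From P R) ∷ S) ⟶ st F F' F* (it F e false P R ∷ S)
    unfold : ∀ {F F' F* S G e B P R e' K K* G'} →
             Extends e P e' →
             F ↭ K ++ instFs e' (P! P ++ P? P ++ P0 P) →
             F* ↭ K* ++ map (instN e') (P* P) →
             G ↭ G' ++ instFs e' (P! P ++ P? P ++ P0 P) →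
             st F F' F* (it G e B P R ∷ S) ⟶
             st (K ++ instFs e' (P! P ++ P? P)) F' (K* ++ υ (map (instN e') (P* P)))
                (q e' R ∷ itT (G' ++ instFs e' (P! P)) e B (instFs e' (P0 P)) P R ∷ S)
    restore : ∀ {F F' F* S G e B H P R} →
             st F F' F* (itT G e B H P R ∷ S) ⟶ st (F ++ H) F' F* (it (G ++ H) e B P R ∷ S)
    commit : ∀ {F F' F* S G e B H P R} →
             st F F' F* (Ok ∷ itT G e B H P R ∷ S) ⟶ st F F' F* (it G e true P R ∷ S)
    it-done-t : ∀ {F F' F* S G e P R} →
             (¬ Σ Env λ e' → Σ Facts λ G' → Decomp G e P e' (P! P ++ P? P ++ P0 P) G') →
             st F F' F* (it G e true P R ∷ S) ⟶ st F F' F* (Ok ∷ S)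
    it-done-f : ∀ {F F' F* S G e P R} →
             (¬ Σ Env λ e' → Σ Facts λ G' → Decomp G e P e' (P! P ++ P? P ++ P0 P) G') →
             st F F' F* (it G e false P R ∷ S) ⟶ st F F' F* S
    new    : ∀ {F F' F*} → st F F' F* (Ok ∷ []) ⟶ New (F ++ F') F*
    fail   : ∀ {F F' F*} → st F F' F* [] ⟶ Fail (F ++ F') F*

  -- The states of R^dml(Q): all queries/conditions in frames come from Q.

  data _≼_ : DML → DML → Set where
    here : ∀ {D} → D ≼ D
    ⊕ˡ   : ∀ {D D₁ D₂} → D ≼ D₁ → D ≼ (D₁ ⊕ D₂)
    ⊕ʳ   : ∀ {D D₁ D₂} → D ≼ D₂ → D ≼ (D₁ ⊕ D₂)
    ⇒r   : ∀ {D φ R} → D ≼ R → D ≼ (φ ⇒ R)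
    From : ∀ {D P R} → D ≼ R → D ≼ From P R

  data _⊑_ : Cond → Cond → Set where
    here : ∀ {ψ} → ψ ⊑ ψ
    neg  : ∀ {ψ φ} → ψ ⊑ φ → ψ ⊑ neg φ
    ∨ˡ   : ∀ {ψ φ₁ φ₂} → ψ ⊑ φ₁ → ψ ⊑ (φ₁ ∨ φ₂)
    ∨ʳ   : ∀ {ψ φ₁ φ₂} → ψ ⊑ φ₂ → ψ ⊑ (φ₁ ∨ φ₂)
    ex   : ∀ {ψ P φ} → ψ ⊑ φ → ψ ⊑ ex P φ

  CondOf : DML → Cond → Set
  CondOf Q ψ = Σ Cond λ φ → Σ DML λ R → ((φ ⇒ R) ≼ Q) × (ψ ⊑ φ)

  data CFrameOf (Q : DML) : CFrame → Set where
    Res : ∀ {b} → CFrameOf Q (Res b)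
    Not : CFrameOf Q Not
    ev  : ∀ {e ψ} → CondOf Q ψ → CFrameOf Q (ev e ψ)
    ev↓ : ∀ {e ψ} → CondOf Q ψ → CFrameOf Q (ev↓ e ψ)
    exI : ∀ {G e P ψ} → CondOf Q (ex P ψ) → CFrameOf Q (exI G e P ψ)

  data AllL {A : Set} (P : A → Set) : List A → Set where
    []  : AllL P []
    _∷_ : ∀ {x xs} → P x → AllL P xs → AllL P (x ∷ xs)

  data DFrameOf (Q : DML) : DFrame → Set where
    Ok  : DFrameOf Q Ok
    q   : ∀ {e R} → R ≼ Q → DFrameOf Q (q e R)
    q↓  : ∀ {e R} → R ≼ Q → DFrameOf Q (q↓ e R)
    cq  : ∀ {e T R} → AllL (CFrameOf Q) T → R ≼ Q → DFrameOf Q (cq e T R)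
    it  : ∀ {G e B P R} → From P R ≼ Q → DFrameOf Q (it G e B P R)
    itT : ∀ {G e B H P R} → From P R ≼ Q → DFrameOf Q (itT G e B H P R)

  StateOf : DML → State → Set
  StateOf Q (st F F' F* S) = AllL (DFrameOf Q) S
  StateOf Q (New _ _)      = ⊤
  StateOf Q (Fail _ _)     = ⊤

  Terminating : DML → Set
  Terminating Q = ¬ (Σ (ℕ → State) λ s → StateOf Q (s 0) × (∀ n → s n ⟶ s (suc n)))

{-# OPTIONS --safe #-}
-- Each state is measured by the list of weights, in ℕ × ℕ ordered lexicographically,
-- of its stack frames (a pending condition contributing the frames of its condition stack),
-- top first.  Every rule replaces a top segment of the stack by frames lighter than the
-- lowest frame of that segment and can only lighten the frames below, and this order on
-- lists is well founded by the nested induction familiar from multiset orderings.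
-- Query and condition frames weigh the size of their subquery or subcondition; iterators
-- additionally weigh the size of their remaining candidates, which a terminating pattern
-- decreases by consuming a ?-fact.  A semi-terminating pattern may only set 0-facts aside,
-- and restoring them undoes the progress; but then its body is success-assured, so an Ok
-- is guaranteed to arrive on top of the tentative iterator and it commits instead.  This
-- guarantee is the Boolean flag threaded down the stack: it only ever turns from false to
-- true, so weighting the tentative iterator like the iterator it is bound to become makes
-- every rule decreasing.
module Submission where

open import Defs

open import Level using (_⊔_)
open import Data.Bool using (Bool; true; false; b≤b; f≤t)
import Data.Bool as Bool
import Data.Bool.Properties as Bool
open import Data.Empty using (⊥)
open import Data.Nat using (ℕ; zero; suc; _+_; _*_; _<_; _≤_; z<s; s≤s)
open import Data.Nat.Properties
  using (n<1+n; m≤n⇒m≤1+n; ≤-refl; m<m+n; m<n+m; m≤m+n; m≤n+m; ≤-trans; ≤-reflexive; <-trans; ≤-<-trans; +-monoʳ-<; *-monoʳ-≤; *-monoʳ-<; *-suc; +-identityʳ)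
open import Data.Nat.Induction using (<-wellFounded)
open import Data.Product using (_×_; _,_)
open import Data.Product.Relation.Binary.Lex.Strict using (×-Lex; ×-transitive; ×-wellFounded)
open import Data.Sum using (_⊎_; inj₁; inj₂)
open import Data.Unit using (⊤; tt)
open import Data.List using (List; []; _∷_; _++_; map; length)
open import Data.List.Properties using (++-assoc; map-++; length-map; length-++)
import Data.List.Relation.Unary.All as All
open All using (All; []; _∷_)
import Data.List.Relation.Binary.Pointwise as Pointwise
open Pointwise using (Pointwise; []; _∷_)
open import Data.List.Relation.Binary.Permutation.Propositional using (_↭_)
open import Data.List.Relation.Binary.Permutation.Propositional.Properties using (↭-length)
open import Relation.Nullary using (contradiction)
open import Relation.Binary.Core using (Rel)
open import Relation.Binary.Definitions using (Transitive)
open import Relation.Binary.PropositionalEquality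
  using (_≡_; _≢_; refl; sym; cong; subst; isEquivalence; resp₂; module ≡-Reasoning)
open import Relation.Binary.Construct.Closure.Reflexive using (ReflClosure; [_])
import Relation.Binary.Construct.Closure.Reflexive as ReflClosure
import Relation.Binary.Construct.Closure.Reflexive.Properties as ReflClosure
open import Induction.WellFounded using (WellFounded; Acc; acc; acc-inverse)

module StackOrder {a ℓ} {A : Set a} (_<_ : Rel A ℓ) where

  infix 4 _≤*_ _◁_

  _≤*_ : Rel (List A) (a ⊔ ℓ)
  _≤*_ = Pointwise (ReflClosure _<_)

  ≤*-refl : ∀ {zs} → zs ≤* zs
  ≤*-refl = Pointwise.refl ReflClosure.refl

  data _◁_ : Rel (List A) (a ⊔ ℓ) where
    here  : ∀ {x ys zs zs'} → All (_< x) ys → zs' ≤* zs → ys ++ zs' ◁ x ∷ zs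
    there : ∀ {x ys zs} → ys ◁ zs → ys ◁ x ∷ zs

  ◁-++ : ∀ {ys zs ys' zs'} → ys ◁ zs → ys' ≤* zs' → ys ++ ys' ◁ zs ++ zs'
  ◁-++ {ys' = ys'} (here {ys = ys} {zs' = zs''} ys<x zs''≤zs) ys'≤zs' =
    subst (_◁ _) (sym (++-assoc ys zs'' ys')) (here ys<x (Pointwise.++⁺ zs''≤zs ys'≤zs'))
  ◁-++ (there ys◁zs) ys'≤zs' = there (◁-++ ys◁zs ys'≤zs')

  module _ (<-trans : Transitive _<_) (<-wf : WellFounded _<_) where

    private
      <-≤-trans : ∀ {x y z} → x < y → ReflClosure _<_ y z → x < z
      <-≤-trans x<y ReflClosure.refl = x<y
      <-≤-trans x<y [ y<z ] = <-trans x<y y<z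

      ≤*-trans : Transitive _≤*_
      ≤*-trans = Pointwise.transitive (ReflClosure.trans <-trans)

    AccBelow : List A → Set (a ⊔ ℓ)
    AccBelow zs = ∀ {zs'} → zs' ≤* zs → Acc _◁_ zs'

    accBelow-∷ : ∀ {x zs} → Acc _<_ x → AccBelow zs → AccBelow (x ∷ zs)
    accBelow-∷ {x} (acc rec) below {x' ∷ zs'} (x'≤x ∷ zs'≤zs) = acc step
      where
      accBelow-++ : ∀ {ys zs} → All (_< x) ys → AccBelow zs → AccBelow (ys ++ zs)
      accBelow-++ [] below = below
      accBelow-++ (y<x ∷ ys<x) below = accBelow-∷ (rec y<x) (accBelow-++ ys<x below)

      step : ∀ {ys} → ys ◁ x' ∷ zs' → Acc _◁_ ys
      step (here ys<x' zs''≤zs') =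
        accBelow-++ (All.map (λ y<x' → <-≤-trans y<x' x'≤x) ys<x')
          (λ ws≤zs'' → below (≤*-trans ws≤zs'' (≤*-trans zs''≤zs' zs'≤zs)))
          ≤*-refl
      step (there ys◁zs') = acc-inverse (below zs'≤zs) ys◁zs'

    ◁-wellFounded : WellFounded _◁_
    ◁-wellFounded zs = accBelow zs ≤*-refl
      where
      accBelow : ∀ zs → AccBelow zs
      accBelow [] [] = acc λ ()
      accBelow (z ∷ zs) = accBelow-∷ (<-wf z) (accBelow zs)

Weight : Set
Weight = ℕ × ℕ

infix 4 _<W_
_<W_ : Rel Weight _
_<W_ = ×-Lex _≡_ _<_ _<_

<W-trans : Transitive _<W_
<W-trans = ×-transitive {_<₁_ = _<_} {_<₂_ = _<_} isEquivalence (resp₂ _<_) <-trans <-trans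

<W-wellFounded : WellFounded _<W_
<W-wellFounded = ×-wellFounded <-wellFounded <-wellFounded

open StackOrder _<W_ using (_≤*_; ≤*-refl; _◁_; here; there; ◁-++)

◁-wellFounded : WellFounded _◁_
◁-wellFounded = StackOrder.◁-wellFounded _<W_ <W-trans <W-wellFounded

≤⇒<2+ : ∀ {m n} → m ≤ n → m < 2 + n
≤⇒<2+ m≤n = s≤s (m≤n⇒m≤1+n m≤n)

suc-2*-< : ∀ {m n} → m < n → suc (2 * m) < 2 * n
suc-2*-< {m} m<n = ≤-trans (≤-reflexive (sym (*-suc 2 m))) (*-monoʳ-≤ 2 m<n)

b≤a∨b : ∀ a b → b Bool.≤ a Bool.∨ b
b≤a∨b true  b = Bool.≤-maximum b
b≤a∨b false b = b≤b

≢[]⇒0<length : ∀ {A : Set} {xs : List A} → xs ≢ [] → 0 < length xs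
≢[]⇒0<length {xs = []}    xs≢[] = contradiction refl xs≢[]
≢[]⇒0<length {xs = _ ∷ _} _     = z<s

length-decomposition : ∀ {A B : Set} (f : A → B) {G G' : List B} X Y → G ↭ G' ++ map f (X ++ Y) →
                       length G ≡ length (G' ++ map f X) + length Y
length-decomposition f {G} {G'} X Y G↭ = begin
  length G                                      ≡⟨ ↭-length G↭ ⟩
  length (G' ++ map f (X ++ Y))                 ≡⟨ cong (λ zs → length (G' ++ zs)) (map-++ f X Y) ⟩
  length (G' ++ (map f X ++ map f Y))           ≡⟨ cong length (sym (++-assoc G' (map f X) (map f Y))) ⟩
  length ((G' ++ map f X) ++ map f Y)           ≡⟨ length-++ (G' ++ map f X) ⟩
  length (G' ++ map f X) + length (map f Y)     ≡⟨ cong (length (G' ++ map f X) +_) (length-map f Y) ⟩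
  length (G' ++ map f X) + length Y             ∎
  where open ≡-Reasoning

module Termination (𝒮 : Setting) where
  open Setting 𝒮
  open System 𝒮

  ≼-wf : ∀ {D Q} → D ≼ Q → WF Q → WF D
  ≼-wf here       w          = w
  ≼-wf (⊕ˡ D≼)    (w₁ ⊕ w₂)  = ≼-wf D≼ w₁
  ≼-wf (⊕ʳ D≼)    (w₁ ⊕ w₂)  = ≼-wf D≼ w₂
  ≼-wf (⇒r D≼)    (_ ⇒ w)    = ≼-wf D≼ w
  ≼-wf (From D≼)  (From _ w) = ≼-wf D≼ w

  ⊑-wf : ∀ {ψ φ} → ψ ⊑ φ → WFCond φ → WFCond ψ
  ⊑-wf here      w         = w
  ⊑-wf (neg ψ⊑)  (neg w)   = ⊑-wf ψ⊑ w
  ⊑-wf (∨ˡ ψ⊑)   (w₁ ∨ w₂) = ⊑-wf ψ⊑ w₁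
  ⊑-wf (∨ʳ ψ⊑)   (w₁ ∨ w₂) = ⊑-wf ψ⊑ w₂
  ⊑-wf (ex ψ⊑)   (ex _ w)  = ⊑-wf ψ⊑ w

  condOf-wf : ∀ {Q ψ} → WF Q → CondOf Q ψ → WFCond ψ
  condOf-wf wfQ (_ , _ , φ⇒R≼Q , ψ⊑φ) with ≼-wf φ⇒R≼Q wfQ
  ... | wfφ ⇒ _ = ⊑-wf ψ⊑φ wfφ

  WFCFrame : CFrame → Set
  WFCFrame (Res _)       = ⊤
  WFCFrame Not           = ⊤
  WFCFrame (ev _ ψ)      = WFCond ψ
  WFCFrame (ev↓ _ ψ)     = WFCond ψ
  WFCFrame (exI _ _ P ψ) = WFCond (ex P ψ)

  WFDFrame : DFrame → Set
  WFDFrame Ok                = ⊤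
  WFDFrame (q _ R)           = WF R
  WFDFrame (q↓ _ R)          = WF R
  WFDFrame (cq _ T R)        = All WFCFrame T × WF R
  WFDFrame (it _ _ _ P R)    = WF (From P R)
  WFDFrame (itT _ _ _ _ P R) = WF (From P R)

  WFState : State → Set
  WFState (st _ _ _ S) = All WFDFrame S
  WFState (New _ _)    = ⊤
  WFState (Fail _ _)   = ⊤

  cframeOf-wf : ∀ {Q T} → WF Q → AllL (CFrameOf Q) T → All WFCFrame T
  cframeOf-wf wfQ []          = []
  cframeOf-wf wfQ (Res ∷ T)   = tt ∷ cframeOf-wf wfQ T
  cframeOf-wf wfQ (Not ∷ T)   = tt ∷ cframeOf-wf wfQ T
  cframeOf-wf wfQ (ev c ∷ T)  = condOf-wf wfQ c ∷ cframeOf-wf wfQ T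
  cframeOf-wf wfQ (ev↓ c ∷ T) = condOf-wf wfQ c ∷ cframeOf-wf wfQ T
  cframeOf-wf wfQ (exI c ∷ T) = condOf-wf wfQ c ∷ cframeOf-wf wfQ T

  dframeOf-wf : ∀ {Q S} → WF Q → AllL (DFrameOf Q) S → All WFDFrame S
  dframeOf-wf wfQ []              = []
  dframeOf-wf wfQ (Ok ∷ S)        = tt ∷ dframeOf-wf wfQ S
  dframeOf-wf wfQ (q R≼ ∷ S)      = ≼-wf R≼ wfQ ∷ dframeOf-wf wfQ S
  dframeOf-wf wfQ (q↓ R≼ ∷ S)     = ≼-wf R≼ wfQ ∷ dframeOf-wf wfQ S
  dframeOf-wf wfQ (cq T R≼ ∷ S)   = (cframeOf-wf wfQ T , ≼-wf R≼ wfQ) ∷ dframeOf-wf wfQ S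
  dframeOf-wf wfQ (it R≼ ∷ S)     = ≼-wf R≼ wfQ ∷ dframeOf-wf wfQ S
  dframeOf-wf wfQ (itT R≼ ∷ S)    = ≼-wf R≼ wfQ ∷ dframeOf-wf wfQ S

  stateOf-wf : ∀ {Q} x → WF Q → StateOf Q x → WFState x
  stateOf-wf (st _ _ _ _) wfQ S = dframeOf-wf wfQ S
  stateOf-wf (New _ _)    _   _ = tt
  stateOf-wf (Fail _ _)   _   _ = tt

  ⟶c-preserves-wf : ∀ {F T T'} → F ⊢ T ⟶c T' → All WFCFrame T → All WFCFrame T'
  ⟶c-preserves-wf r-false       (_ ∷ T)         = tt ∷ T
  ⟶c-preserves-wf r-bool        (_ ∷ T)         = tt ∷ T
  ⟶c-preserves-wf r-neg         (neg w ∷ T)     = w ∷ tt ∷ T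
  ⟶c-preserves-wf r-not         (_ ∷ _ ∷ T)     = tt ∷ T
  ⟶c-preserves-wf r-or          ((w₁ ∨ w₂) ∷ T) = w₂ ∷ w₁ ∷ T
  ⟶c-preserves-wf r-or-t        (_ ∷ _ ∷ T)     = tt ∷ T
  ⟶c-preserves-wf r-or-f        (_ ∷ w ∷ T)     = w ∷ T
  ⟶c-preserves-wf r-ex          (w ∷ T)         = w ∷ T
  ⟶c-preserves-wf (r-match _)   (ex tp w ∷ T)   = w ∷ ex tp w ∷ T
  ⟶c-preserves-wf r-ex-f        (_ ∷ T)         = T
  ⟶c-preserves-wf r-ex-t        (_ ∷ _ ∷ T)     = tt ∷ T
  ⟶c-preserves-wf (r-nomatch _) (_ ∷ T)         = tt ∷ T

  ⟶-preserves-wf : ∀ {x y} → x ⟶ y → WFState x → WFState y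
  ⟶-preserves-wf ok-ok            (_ ∷ _ ∷ S)     = tt ∷ S
  ⟶-preserves-wf q-ok             (_ ∷ S)         = tt ∷ S
  ⟶-preserves-wf q-∅              (_ ∷ S)         = S
  ⟶-preserves-wf q-fact           (_ ∷ S)         = tt ∷ S
  ⟶-preserves-wf q-⊕              ((w₁ ⊕ w₂) ∷ S) = w₁ ∷ w₂ ∷ S
  ⟶-preserves-wf ↓-ok             (_ ∷ w ∷ S)     = w ∷ tt ∷ S
  ⟶-preserves-wf ↓-top            (w ∷ S)         = w ∷ S
  ⟶-preserves-wf q-⇒              ((wφ ⇒ w) ∷ S)  = ((wφ ∷ []) , w) ∷ S
  ⟶-preserves-wf (cq-step c)      ((T , w) ∷ S)   = (⟶c-preserves-wf c T , w) ∷ S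
  ⟶-preserves-wf cq-f             (_ ∷ S)         = S
  ⟶-preserves-wf cq-t             ((_ , w) ∷ S)   = w ∷ S
  ⟶-preserves-wf q-From           (w ∷ S)         = w ∷ S
  ⟶-preserves-wf (unfold _ _ _ _) (From c w ∷ S)  = w ∷ From c w ∷ S
  ⟶-preserves-wf restore          (w ∷ S)         = w ∷ S
  ⟶-preserves-wf commit           (_ ∷ w ∷ S)     = w ∷ S
  ⟶-preserves-wf (it-done-t _)    (_ ∷ S)         = tt ∷ S
  ⟶-preserves-wf (it-done-f _)    (_ ∷ S)         = S
  ⟶-preserves-wf new              _               = tt
  ⟶-preserves-wf fail             _               = tt

  condSize : Cond → ℕ
  condSize False     = 1
  condSize (bool _)  = 1
  condSize (neg ψ)   = 2 + condSize ψ
  condSize (ψ₁ ∨ ψ₂) = 2 + (condSize ψ₁ + condSize ψ₂)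
  condSize (ex _ ψ)  = 2 + condSize ψ

  cframeWeight : CFrame → Weight
  cframeWeight (Res _)       = 0 , 0
  cframeWeight Not           = 1 , 0
  cframeWeight (ev _ ψ)      = condSize ψ , 0
  cframeWeight (ev↓ _ ψ)     = suc (condSize ψ) , 0
  cframeWeight (exI G _ _ ψ) = suc (condSize ψ) , length G

  ⟶c-decreasing : ∀ {F T T'} → All WFCFrame T → F ⊢ T ⟶c T' →
                  map cframeWeight T' ◁ map cframeWeight T
  ⟶c-decreasing _ r-false = here (inj₁ z<s ∷ []) ≤*-refl
  ⟶c-decreasing _ r-bool  = here (inj₁ z<s ∷ []) ≤*-refl
  ⟶c-decreasing _ r-neg   = here (inj₁ (≤⇒<2+ ≤-refl) ∷ inj₁ (s≤s z<s) ∷ []) ≤*-refl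
  ⟶c-decreasing _ r-not   = there (here (inj₁ z<s ∷ []) ≤*-refl)
  ⟶c-decreasing _ (r-or {ψ₁ = ψ₁} {ψ₂}) =
    here (inj₁ (≤⇒<2+ (m≤n+m _ (condSize ψ₁))) ∷ inj₁ (s≤s (s≤s (m≤m+n _ (condSize ψ₂)))) ∷ []) ≤*-refl
  ⟶c-decreasing _ r-or-t  = there (here (inj₁ z<s ∷ []) ≤*-refl)
  ⟶c-decreasing _ r-or-f  = there (here (inj₁ (n<1+n _) ∷ []) ≤*-refl)
  ⟶c-decreasing _ r-ex    = here (inj₁ (n<1+n _) ∷ []) ≤*-refl
  ⟶c-decreasing (ex (_ , _ , P?≢[]) _ ∷ _) (r-match {G} {P = P} {e' = e'} {G' = G'} (_ , G↭)) =
    here (inj₁ (n<1+n _) ∷ inj₂ (refl , shrinks) ∷ []) ≤*-refl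
    where
    shrinks : length (G' ++ instFs e' (P! P)) < length G
    shrinks = subst (_ <_) (sym (length-decomposition (instF e') (P! P) (P? P) G↭))
                (m<m+n _ (≢[]⇒0<length P?≢[]))
  ⟶c-decreasing _ r-ex-f  = here [] ≤*-refl
  ⟶c-decreasing _ r-ex-t  = there (here (inj₁ z<s ∷ []) ≤*-refl)
  ⟶c-decreasing _ (r-nomatch _) = here (inj₁ z<s ∷ []) ≤*-refl

  isSuccessAssured : DML → Bool
  isSuccessAssured ok         = true
  isSuccessAssured ∅          = false
  isSuccessAssured (fact _)   = true
  isSuccessAssured (R₁ ⊕ R₂)  = isSuccessAssured R₁ Bool.∨ isSuccessAssured R₂
  isSuccessAssured (_ ⇒ _)    = false
  isSuccessAssured (From _ _) = false

  isSuccessAssured-complete : ∀ {R} → SuccessAssured R → isSuccessAssured R ≡ true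
  isSuccessAssured-complete ok              = refl
  isSuccessAssured-complete fact            = refl
  isSuccessAssured-complete (⊕ˡ sa)         rewrite isSuccessAssured-complete sa = refl
  isSuccessAssured-complete (⊕ʳ {D₁} sa)    rewrite isSuccessAssured-complete sa = Bool.∨-zeroʳ (isSuccessAssured D₁)

  frameAssured : DFrame → Bool
  frameAssured Ok                = true
  frameAssured (q _ R)           = isSuccessAssured R
  frameAssured (q↓ _ R)          = isSuccessAssured R
  frameAssured (cq _ _ _)        = false
  frameAssured (it _ _ B _ _)    = B
  frameAssured (itT _ _ B _ _ _) = B

  querySize : DML → ℕ
  querySize ok         = 1
  querySize ∅          = 1
  querySize (fact _)   = 1
  querySize (R₁ ⊕ R₂)  = 2 + (querySize R₁ + querySize R₂)
  querySize (φ ⇒ R)    = 2 + (condSize φ + querySize R)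
  querySize (From _ R) = 2 + querySize R

  -- An iterator over G weighs 2 |G|; a tentative one weighs just above the iterator it
  -- turns into: it G by commit when an Ok is assured to reach it, else it (G ++ H) by restore.
  tentativeWeight : Bool → ℕ → ℕ → ℕ
  tentativeWeight true  n h = suc (2 * n)
  tentativeWeight false n h = suc (2 * (n + h))

  frameWeights : Bool → DFrame → List Weight
  frameWeights a Ok                = (0 , 0) ∷ []
  frameWeights a (q _ R)           = (querySize R , 0) ∷ []
  frameWeights a (q↓ _ R)          = (suc (querySize R) , 0) ∷ []
  frameWeights a (cq _ T R)        = map cframeWeight T ++ (suc (querySize R) , 0) ∷ []
  frameWeights a (it G _ _ _ R)    = (suc (querySize R) , 2 * length G) ∷ []
  frameWeights a (itT G _ _ H _ R) = (suc (querySize R) , tentativeWeight a (length G) (length H)) ∷ []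

  -- The flag records that some frame above is bound to leave an Ok.  The bottom weight pays
  -- for the final step to New or Fail.
  stackWeights : Bool → DStack → List Weight
  stackWeights a []      = (0 , 0) ∷ []
  stackWeights a (f ∷ S) = frameWeights a f ++ stackWeights (a Bool.∨ frameAssured f) S

  stateWeights : State → List Weight
  stateWeights (st _ _ _ S) = stackWeights false S
  stateWeights (New _ _)    = []
  stateWeights (Fail _ _)   = []

  tentativeWeight-antitone : ∀ {a b} n h → a Bool.≤ b →
                             ReflClosure _<_ (tentativeWeight b n h) (tentativeWeight a n h)
  tentativeWeight-antitone n zero    f≤t = ReflClosure.reflexive (cong (λ m → suc (2 * m)) (sym (+-identityʳ n)))
  tentativeWeight-antitone n (suc h) f≤t = [ s≤s (*-monoʳ-< 2 (m<m+n n z<s)) ]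
  tentativeWeight-antitone n h       b≤b = ReflClosure.refl

  tentativeWeight-≤ : ∀ a n h → tentativeWeight a n h ≤ suc (2 * (n + h))
  tentativeWeight-≤ true  n h = s≤s (*-monoʳ-≤ 2 (m≤m+n n h))
  tentativeWeight-≤ false n h = ≤-refl

  tentativeWeight<2* : ∀ a n p h → 0 < p ⊎ (a ≡ true × 0 < h) → tentativeWeight a n h < 2 * (n + (p + h))
  tentativeWeight<2* a    n p h (inj₁ 0<p)          =
    ≤-<-trans (tentativeWeight-≤ a n h) (suc-2*-< (+-monoʳ-< n (m<n+m h 0<p)))
  tentativeWeight<2* true n p h (inj₂ (refl , 0<h)) = suc-2*-< (m<m+n n (≤-trans 0<h (m≤n+m h p)))

  frameWeights-antitone : ∀ {a b} f → a Bool.≤ b → frameWeights b f ≤* frameWeights a f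
  frameWeights-antitone Ok                a≤b = ≤*-refl
  frameWeights-antitone (q _ _)           a≤b = ≤*-refl
  frameWeights-antitone (q↓ _ _)          a≤b = ≤*-refl
  frameWeights-antitone (cq _ _ _)        a≤b = ≤*-refl
  frameWeights-antitone (it _ _ _ _ _)    a≤b = ≤*-refl
  frameWeights-antitone (itT G _ _ H _ R) a≤b =
    ReflClosure.map (λ lt → inj₂ (refl , lt)) (tentativeWeight-antitone (length G) (length H) a≤b) ∷ []

  stackWeights-antitone : ∀ {a b} S → a Bool.≤ b → stackWeights b S ≤* stackWeights a S
  stackWeights-antitone []      a≤b = ≤*-refl
  stackWeights-antitone (f ∷ S) a≤b =
    Pointwise.++⁺ (frameWeights-antitone f a≤b) (stackWeights-antitone S (∨-monoˡ-≤ a≤b))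
    where
    ∨-monoˡ-≤ : ∀ {a b c} → a Bool.≤ b → a Bool.∨ c Bool.≤ b Bool.∨ c
    ∨-monoˡ-≤         b≤b = b≤b
    ∨-monoˡ-≤ {c = c} f≤t = Bool.≤-maximum c

  unfold-progress : ∀ {P R} → TerminatingP P ⊎ (SemiTerminating P × SuccessAssured R) →
                    0 < length (P? P) ⊎ (isSuccessAssured R ≡ true × 0 < length (P0 P))
  unfold-progress                      (inj₁ P?≢[])        = inj₁ (≢[]⇒0<length P?≢[])
  unfold-progress {pat _ (_ ∷ _) _ _} (inj₂ _)            = inj₁ z<s
  unfold-progress {pat _ [] _ _}      (inj₂ (P0≢[] , sa)) =
    inj₂ (isSuccessAssured-complete sa , ≢[]⇒0<length P0≢[])

  unfold-lightens : ∀ {G G' e P R} → WF (From P R) → G ↭ G' ++ instFs e (P! P ++ P? P ++ P0 P) →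
                    tentativeWeight (isSuccessAssured R) (length (G' ++ instFs e (P! P))) (length (instFs e (P0 P)))
                    < 2 * length G
  unfold-lightens {e = e} {P} {R} (From progress _) G↭
    rewrite length-decomposition (instF e) (P! P) (P? P ++ P0 P) G↭ | length-++ (P? P) {P0 P}
          | length-map (instF e) (P0 P)
    = tentativeWeight<2* _ _ _ _ (unfold-progress {P} {R} progress)

  ⟶-decreasing : ∀ {x y} → WFState x → x ⟶ y → stateWeights y ◁ stateWeights x
  ⟶-decreasing _ ok-ok  = here [] ≤*-refl
  ⟶-decreasing _ q-ok   = here (inj₁ z<s ∷ []) ≤*-refl
  ⟶-decreasing _ q-∅    = here [] ≤*-refl
  ⟶-decreasing _ q-fact = here (inj₁ z<s ∷ []) ≤*-refl
  ⟶-decreasing _ (q-⊕ {R₁ = R₁} {R₂}) =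
    here (inj₁ (≤⇒<2+ (m≤m+n _ (querySize R₂))) ∷ inj₁ (s≤s (s≤s (m≤n+m _ (querySize R₁)))) ∷ []) ≤*-refl
  ⟶-decreasing _ (↓-ok {S = S} {R = R}) =
    there (here (inj₁ (n<1+n _) ∷ inj₁ z<s ∷ []) (stackWeights-antitone S (b≤a∨b (isSuccessAssured R) true)))
  ⟶-decreasing _ ↓-top = here (inj₁ (n<1+n _) ∷ []) ≤*-refl
  ⟶-decreasing _ (q-⇒ {φ = φ} {R}) =
    here (inj₁ (≤⇒<2+ (m≤m+n _ (querySize R))) ∷ inj₁ (s≤s (s≤s (m≤n+m _ (condSize φ)))) ∷ []) ≤*-refl
  ⟶-decreasing ((T , _) ∷ _) (cq-step c) = ◁-++ (◁-++ (⟶c-decreasing T c) ≤*-refl) ≤*-refl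
  ⟶-decreasing _ cq-f = there (here [] ≤*-refl)
  ⟶-decreasing _ (cq-t {S = S}) =
    there (here (inj₁ (n<1+n _) ∷ []) (stackWeights-antitone S (Bool.≤-minimum _)))
  ⟶-decreasing _ q-From = here (inj₁ (n<1+n _) ∷ []) ≤*-refl
  ⟶-decreasing (wfIt ∷ _) (unfold {S = S} {B = B} {R = R} _ _ _ G↭) =
    here (inj₁ (n<1+n _) ∷ inj₂ (refl , unfold-lightens wfIt G↭) ∷ [])
      (stackWeights-antitone S (b≤a∨b (isSuccessAssured R) B))
  ⟶-decreasing _ (restore {G = G}) =
    here (inj₂ (refl , s≤s (≤-reflexive (cong (2 *_) (length-++ G)))) ∷ []) ≤*-refl
  ⟶-decreasing _ commit = there (here (inj₂ (refl , n<1+n _) ∷ []) ≤*-refl)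
  ⟶-decreasing _ (it-done-t _) = here (inj₁ z<s ∷ []) ≤*-refl
  ⟶-decreasing _ (it-done-f _) = here [] ≤*-refl
  ⟶-decreasing _ new  = there (here [] ≤*-refl)
  ⟶-decreasing _ fail = here [] ≤*-refl

theorem47 : (𝒮 : Setting) → (Q : System.DML 𝒮) → System.WF 𝒮 Q → System.Terminating 𝒮 Q
theorem47 𝒮 Q wfQ (s , s₀ , step) =
  descend 0 (stateOf-wf (s 0) wfQ s₀) (◁-wellFounded (stateWeights (s 0)))
  where
  open Termination 𝒮
  descend : ∀ n → WFState (s n) → Acc _◁_ (stateWeights (s n)) → ⊥
  descend n wf (acc rec) =
    descend (suc n) (⟶-preserves-wf (step n) wf) (rec (⟶-decreasing wf (step n)))
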